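{- Let $G$ be a simple graph with vertex set $V=\{v_1,\dots,v_n\}$ and maximum degree $\Delta$. Let $G^\sigma$ be an oriented graph of $G$ with skew adjacency matrix $S=(S_1,\dots,S_n)$, where $S_k$ denotes the $k$-th column of $S$. If there exists a vertex $v_k$ with $d_G(v_k)=\Delta$ such that $S_k^TS_j=0$ for every $j\neq k$, then $\mathrm{i}\sqrt{\Delta}$ (with $\mathrm{i}$ the imaginary unit) is an eigenvalue of $S$.
   Context: An oriented graph $G^\sigma$ of a simple graph $G$ on vertices $v_1,\dots,v_n$ is obtained by giving each edge of $G$ one of its two directions. Its skew adjacency matrix $S=(s_{ij})$ has $s_{ij}=1$, $s_{ji}=-1$ if $\langle v_i,v_j\rangle$ is an arc, and $s_{ij}=s_{ji}=0$ otherwise. The eigenvalues of $G^\sigma$ are those of $S$. $d_G(v)$ denotes the degree of $v$ in $G$. -}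

module Defs where

open import Data.Bool using (Bool; true; false; if_then_else_; _xor_)
open import Data.Nat as ℕ using (ℕ; _⊔_)
open import Data.Integer as ℤ using (ℤ)
open import Data.Rational as ℚ using (ℚ; 0ℚ; 1ℚ)
open import Data.Fin using (Fin)
open import Data.List using (List; foldr; allFin; map; filter; length)
open import Data.Product using (Σ; ∃; _×_; _,_)
open import Relation.Nullary using (¬_)
open import Relation.Binary.PropositionalEquality using (_≡_; _≢_)

record SimpleGraph (n : ℕ) : Set where
  field
    Adj   : Fin n → Fin n → Bool
    sym   : ∀ i j → Adj i j ≡ Adj j i
    irrefl : ∀ i → Adj i i ≡ false
open SimpleGraph public

degree : ∀ {n} → SimpleGraph n → Fin n → ℕ
degree G i = length (filter (λ j → Data.Bool._≟_ (Adj G i j) true) (allFin _))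
  where import Data.Bool

-- Δ(G): maximum degree (0 for the empty graph)
maxDegree : ∀ {n} → SimpleGraph n → ℕ
maxDegree G = foldr _⊔_ 0 (map (degree G) (allFin _))

-- Orientations: arc i j = true  means  ⟨v_i , v_j⟩ is an arc.
-- Every edge gets exactly one of its two directions; non-edges get none.

record Orientation {n : ℕ} (G : SimpleGraph n) : Set where
  field
    arc      : Fin n → Fin n → Bool
    arc⇒edge : ∀ i j → arc i j ≡ true → Adj G i j ≡ true
    edge⇒one : ∀ i j → Adj G i j ≡ true → (arc i j xor arc j i) ≡ true
open Orientation public

skewAdj : ∀ {n} {G : SimpleGraph n} → Orientation G → Fin n → Fin n → ℤ
skewAdj σ i j =
  if arc σ i j then ℤ.+ 1 else (if arc σ j i then ℤ.- (ℤ.+ 1) else ℤ.+ 0)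

sumℤ : ∀ {n} → (Fin n → ℤ) → ℤ
sumℤ f = foldr ℤ._+_ (ℤ.+ 0) (map f (allFin _))

colDot : ∀ {n} → (Fin n → Fin n → ℤ) → Fin n → Fin n → ℤ
colDot S k j = sumℤ (λ i → S i k ℤ.* S i j)

-- The subfield ℚ(i, √D) of ℂ, for a natural number D.
-- A "real" element  a + c·√D  (a c : ℚ), with √D the nonnegative root.

record ℝD : Set where
  constructor _+√_
  field
    ra : ℚ
    rc : ℚ
open ℝD public

-- a + c√D = 0 as a real number  ⟺  a² = c²·D  and  a·c ≤ 0
IsZeroℝ : ℕ → ℝD → Set
IsZeroℝ D x =
  (ra x ℚ.* ra x ≡ rc x ℚ.* rc x ℚ.* (ℤ.+ D ℚ./ 1)) × (ra x ℚ.* rc x ℚ.≤ 0ℚ)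

addℝ : ℝD → ℝD → ℝD
addℝ x y = (ra x ℚ.+ ra y) +√ (rc x ℚ.+ rc y)

negℝ : ℝD → ℝD
negℝ x = (ℚ.- ra x) +√ (ℚ.- rc x)

mulℝ : ℕ → ℝD → ℝD → ℝD
mulℝ D x y =
  (ra x ℚ.* ra y ℚ.+ rc x ℚ.* rc y ℚ.* (ℤ.+ D ℚ./ 1))
    +√ (ra x ℚ.* rc y ℚ.+ rc x ℚ.* ra y)

record ℂD : Set where
  constructor _+i_
  field
    re : ℝD
    im : ℝD
open ℂD public

IsZeroℂ : ℕ → ℂD → Set
IsZeroℂ D z = IsZeroℝ D (re z) × IsZeroℝ D (im z)

zeroℝ : ℝD
zeroℝ = 0ℚ +√ 0ℚ

zeroℂ : ℂD
zeroℂ = zeroℝ +i zeroℝ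

addℂ : ℂD → ℂD → ℂD
addℂ z w = addℝ (re z) (re w) +i addℝ (im z) (im w)

subℂ : ℂD → ℂD → ℂD
subℂ z w = addℂ z (negℝ (re w) +i negℝ (im w))

mulℂ : ℕ → ℂD → ℂD → ℂD
mulℂ D z w =
  addℝ (mulℝ D (re z) (re w)) (negℝ (mulℝ D (im z) (im w)))
    +i addℝ (mulℝ D (re z) (im w)) (mulℝ D (im z) (re w))

fromℤℂ : ℤ → ℂD
fromℤℂ z = ((z ℚ./ 1) +√ 0ℚ) +i zeroℝ

i√ : (D : ℕ) → ℂD
i√ D = zeroℝ +i (0ℚ +√ 1ℚ)

mulVec : ∀ {n} → ℕ → (Fin n → Fin n → ℤ) → (Fin n → ℂD) → Fin n → ℂD
mulVec D M x i = foldr addℂ zeroℂ (map (λ j → mulℂ D (fromℤℂ (M i j)) (x j)) (allFin _))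

IsEigenvalue : ∀ {n} (D : ℕ) → (Fin n → Fin n → ℤ) → ℂD → Set
IsEigenvalue {n} D M λ' =
  Σ (Fin n → ℂD) λ x →
    (∃ λ j → ¬ IsZeroℂ D (x j)) ×
    (∀ i → IsZeroℂ D (subℂ (mulVec D M x i) (mulℂ D λ' (x i))))

-- Since Sᵀ = −S, the vector S Sₖ has entries −Sᵢᵀ Sₖ, and the hypotheses make it −Δ eₖ
-- (Sₖᵀ Sₖ = d(vₖ) = Δ, as Sₖ has entries ±1 exactly at the neighbours of vₖ). Hence
-- x = Sₖ + i√Δ eₖ satisfies S x = −Δ eₖ + i√Δ Sₖ = i√Δ x, and x ≠ 0 because xₖ has imaginary part √Δ.
-- For Δ = 0 this x vanishes; then Sₖ = 0 and eₖ is an eigenvector for i√0 = 0.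
-- Writing vectors over ℚ(i, √Δ) as (a + b√Δ) + i(c + d√Δ) with integer vectors a, b, c, d turns
-- the eigen-equation into integer identities.

module Submission where

open import Defs hiding (sym)
open import Data.Nat using (ℕ)
open import Data.Integer using (ℤ; +_)
open import Data.Fin using (Fin)
open import Data.Product using (∃; _×_)
open import Relation.Binary.PropositionalEquality using (_≡_; _≢_)

open import Data.Bool using (true; false; if_then_else_; _xor_; _≟_)
open import Data.Bool.Properties using (¬-not)
open import Data.Empty using (⊥; ⊥-elim)
open import Data.Fin as Fin using (zero; suc; punchIn)
open import Data.Fin.Properties using (punchInᵢ≢i)
import Data.Integer as ℤ
import Data.Integer.Properties as ℤP
open import Algebra.Properties.Semiring.Sum ℤP.+-*-semiring
  using (sum; sum-cong-≗; sum-remove; sum-replicate-zero; *-distribˡ-sum)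
open import Data.List using (_∷_; []; foldr; map; filter; length; tabulate; allFin)
open import Data.List.Properties using (map-cong)
open import Data.List.Membership.Propositional using (_∈_)
open import Data.List.Membership.Propositional.Properties using (∈-allFin; ∈-filter⁺; ∈-length)
open import Data.Nat as ℕ using (zero; suc)
open import Data.Product using (_,_; proj₁; proj₂)
open import Data.Rational as ℚ using (ℚ; 0ℚ; 1ℚ)
import Data.Rational.Properties as ℚP
open ℚP using (toℚᵘ-injective; toℚᵘ-fromℚᵘ)
open import Data.Rational.Solver using (module +-*-Solver)
open import Data.Rational.Unnormalised as ℚᵘ using (mkℚᵘ; *≡*)
import Data.Rational.Unnormalised.Properties as ℚᵘP
open ℚᵘP using (≃-trans; ≃-sym)
open import Function using (_∘_; id)
open import Relation.Nullary using (¬_; Dec; yes; no; does; contradiction)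
open import Relation.Nullary.Decidable using (dec-true; dec-false)
open import Relation.Unary using (Pred; Decidable)
open import Relation.Binary.PropositionalEquality
  using (refl; sym; trans; cong; cong₂; subst; subst₂; _≗_; module ≡-Reasoning)

open ≡-Reasoning

fromℚᵘ-homo-+ : ∀ p q → ℚ.fromℚᵘ (p ℚᵘ.+ q) ≡ ℚ.fromℚᵘ p ℚ.+ ℚ.fromℚᵘ q
fromℚᵘ-homo-+ p q = toℚᵘ-injective (≃-trans (toℚᵘ-fromℚᵘ (p ℚᵘ.+ q)) (≃-sym
  (≃-trans (ℚP.toℚᵘ-homo-+ (ℚ.fromℚᵘ p) (ℚ.fromℚᵘ q)) (ℚᵘP.+-cong (toℚᵘ-fromℚᵘ p) (toℚᵘ-fromℚᵘ q)))))

fromℚᵘ-homo-* : ∀ p q → ℚ.fromℚᵘ (p ℚᵘ.* q) ≡ ℚ.fromℚᵘ p ℚ.* ℚ.fromℚᵘ q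
fromℚᵘ-homo-* p q = toℚᵘ-injective (≃-trans (toℚᵘ-fromℚᵘ (p ℚᵘ.* q)) (≃-sym
  (≃-trans (ℚP.toℚᵘ-homo-* (ℚ.fromℚᵘ p) (ℚ.fromℚᵘ q)) (ℚᵘP.*-cong (toℚᵘ-fromℚᵘ p) (toℚᵘ-fromℚᵘ q)))))

fromℚᵘ-homo‿- : ∀ p → ℚ.fromℚᵘ (ℚᵘ.- p) ≡ ℚ.- ℚ.fromℚᵘ p
fromℚᵘ-homo‿- p = toℚᵘ-injective (≃-trans (toℚᵘ-fromℚᵘ (ℚᵘ.- p)) (≃-sym
  (≃-trans (ℚP.toℚᵘ-homo‿- (ℚ.fromℚᵘ p)) (ℚᵘP.-‿cong (toℚᵘ-fromℚᵘ p)))))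

-- fromℤ z is definitionally ℚ.fromℚᵘ (mkℚᵘ z 0), so its properties are read off from ℚᵘ.
fromℤ : ℤ → ℚ
fromℤ z = z ℚ./ 1

fromℤ-homo-+ : ∀ a b → fromℤ (a ℤ.+ b) ≡ fromℤ a ℚ.+ fromℤ b
fromℤ-homo-+ a b =
  trans (cong fromℤ (cong₂ ℤ._+_ (sym (ℤP.*-identityʳ a)) (sym (ℤP.*-identityʳ b))))
        (fromℚᵘ-homo-+ (mkℚᵘ a 0) (mkℚᵘ b 0))

fromℤ-homo-* : ∀ a b → fromℤ (a ℤ.* b) ≡ fromℤ a ℚ.* fromℤ b
fromℤ-homo-* a b = fromℚᵘ-homo-* (mkℚᵘ a 0) (mkℚᵘ b 0)

fromℤ-homo‿- : ∀ a → fromℤ (ℤ.- a) ≡ ℚ.- fromℤ a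
fromℤ-homo‿- a = fromℚᵘ-homo‿- (mkℚᵘ a 0)

fromℤ-injective : ∀ {a b} → fromℤ a ≡ fromℤ b → a ≡ b
fromℤ-injective {a} {b} eq
  with ≃-trans (≃-sym (toℚᵘ-fromℚᵘ (mkℚᵘ a 0))) (≃-trans (ℚP.toℚᵘ-cong eq) (toℚᵘ-fromℚᵘ (mkℚᵘ b 0)))
... | *≡* a*1≡b*1 = trans (sym (ℤP.*-identityʳ a)) (trans a*1≡b*1 (ℤP.*-identityʳ b))

sum-tabulate : ∀ {A : Set} {m} (f : A → ℤ) (g : Fin m → A) →
  foldr ℤ._+_ (+ 0) (map f (tabulate g)) ≡ sum (f ∘ g)
sum-tabulate {m = zero}  f g = refl
sum-tabulate {m = suc m} f g = cong (ℤ._+_ (f (g zero))) (sum-tabulate f (g ∘ suc))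

sumℤ≡sum : ∀ {n} (f : Fin n → ℤ) → sumℤ f ≡ sum f
sumℤ≡sum f = sum-tabulate f id

sum-zero : ∀ {n} {f : Fin n → ℤ} → (∀ j → f j ≡ + 0) → sum f ≡ + 0
sum-zero {n} f≡0 = trans (sum-cong-≗ f≡0) (sum-replicate-zero n)

sumℤ-cong : ∀ {n} {f g : Fin n → ℤ} → f ≗ g → sumℤ f ≡ sumℤ g
sumℤ-cong {n} f≗g = cong (foldr ℤ._+_ (+ 0)) (map-cong f≗g (allFin n))

sumℤ-zero : ∀ {n} {f : Fin n → ℤ} → (∀ j → f j ≡ + 0) → sumℤ f ≡ + 0
sumℤ-zero {f = f} f≡0 = trans (sumℤ≡sum f) (sum-zero f≡0)

sumℤ-single : ∀ {n} (f : Fin n → ℤ) k → (∀ j → j ≢ k → f j ≡ + 0) → sumℤ f ≡ f k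
sumℤ-single {suc n} f k f-off-k = begin
  sumℤ f                       ≡⟨ sumℤ≡sum f ⟩
  sum f                        ≡⟨ sum-remove {i = k} f ⟩
  f k ℤ.+ sum (f ∘ punchIn k)  ≡⟨ cong (ℤ._+_ (f k)) (sum-zero (λ j → f-off-k _ (punchInᵢ≢i k j))) ⟩
  f k ℤ.+ + 0                  ≡⟨ ℤP.+-identityʳ (f k) ⟩
  f k                          ∎

sumℤ-neg : ∀ {n} (f : Fin n → ℤ) → sumℤ (λ j → ℤ.- f j) ≡ ℤ.- sumℤ f
sumℤ-neg f = begin
  sumℤ (λ j → ℤ.- f j)       ≡⟨ sumℤ≡sum (λ j → ℤ.- f j) ⟩
  sum (λ j → ℤ.- f j)        ≡⟨ sum-cong-≗ (λ j → ℤP.-1*i≡-i (f j)) ⟨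
  sum (λ j → ℤ.-1ℤ ℤ.* f j)  ≡⟨ *-distribˡ-sum ℤ.-1ℤ f ⟨
  ℤ.-1ℤ ℤ.* sum f            ≡⟨ ℤP.-1*i≡-i (sum f) ⟩
  ℤ.- sum f                  ≡⟨ cong ℤ.-_ (sumℤ≡sum f) ⟨
  ℤ.- sumℤ f                 ∎

sum-indicator≡count : ∀ {A : Set} {p} {P : Pred A p} (P? : Decidable P) (f : A → ℤ) →
  (∀ x → P x → f x ≡ + 1) → (∀ x → ¬ P x → f x ≡ + 0) →
  ∀ xs → foldr ℤ._+_ (+ 0) (map f xs) ≡ + length (filter P? xs)
sum-indicator≡count P? f f-in f-out [] = refl
sum-indicator≡count P? f f-in f-out (x ∷ xs) with P? x
... | yes px = cong₂ ℤ._+_ (f-in x px) (sum-indicator≡count P? f f-in f-out xs)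
... | no ¬px = trans (cong₂ ℤ._+_ (f-out x ¬px) (sum-indicator≡count P? f f-in f-out xs))
                     (ℤP.+-identityˡ _)

ℂD-cong : ∀ {a b c d a′ b′ c′ d′ : ℚ} → a ≡ a′ → b ≡ b′ → c ≡ c′ → d ≡ d′ →
  (a +√ b) +i (c +√ d) ≡ (a′ +√ b′) +i (c′ +√ d′)
ℂD-cong refl refl refl refl = refl

fromℤ⁴ : ℤ → ℤ → ℤ → ℤ → ℂD
fromℤ⁴ a b c d = (fromℤ a +√ fromℤ b) +i (fromℤ c +√ fromℤ d)

addℂ-fromℤ⁴ : ∀ a b c d a′ b′ c′ d′ →
  addℂ (fromℤ⁴ a b c d) (fromℤ⁴ a′ b′ c′ d′)
    ≡ fromℤ⁴ (a ℤ.+ a′) (b ℤ.+ b′) (c ℤ.+ c′) (d ℤ.+ d′)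
addℂ-fromℤ⁴ a b c d a′ b′ c′ d′ =
  sym (ℂD-cong (fromℤ-homo-+ a a′) (fromℤ-homo-+ b b′) (fromℤ-homo-+ c c′) (fromℤ-homo-+ d d′))

sumℂ-fromℤ⁴ : ∀ {A : Set} (a b c d : A → ℤ) xs →
  let Σ : (A → ℤ) → ℤ
      Σ f = foldr ℤ._+_ (+ 0) (map f xs)
  in foldr addℂ zeroℂ (map (λ x → fromℤ⁴ (a x) (b x) (c x) (d x)) xs)
       ≡ fromℤ⁴ (Σ a) (Σ b) (Σ c) (Σ d)
sumℂ-fromℤ⁴ a b c d [] = refl
sumℂ-fromℤ⁴ {A} a b c d (x ∷ xs) =
  trans (cong (addℂ (fromℤ⁴ (a x) (b x) (c x) (d x))) (sumℂ-fromℤ⁴ a b c d xs))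
        (addℂ-fromℤ⁴ (a x) (b x) (c x) (d x) (Σ a) (Σ b) (Σ c) (Σ d))
  where
  Σ : (A → ℤ) → ℤ
  Σ f = foldr ℤ._+_ (+ 0) (map f xs)

module _ (D : ℕ) where
  open +-*-Solver

  private
    Dℚ : ℚ
    Dℚ = fromℤ (+ D)

  mulℂ-real : ∀ r a b c d → mulℂ D ((r +√ 0ℚ) +i zeroℝ) ((a +√ b) +i (c +√ d))
    ≡ ((r ℚ.* a) +√ (r ℚ.* b)) +i ((r ℚ.* c) +√ (r ℚ.* d))
  mulℂ-real r a b c d = ℂD-cong
    (solve 6 (λ r a b c d δ →
      (r :* a :+ con 0ℚ :* b :* δ) :+ :- (con 0ℚ :* c :+ con 0ℚ :* d :* δ) := r :* a) refl r a b c d Dℚ)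
    (solve 5 (λ r a b c d →
      (r :* b :+ con 0ℚ :* a) :+ :- (con 0ℚ :* d :+ con 0ℚ :* c) := r :* b) refl r a b c d)
    (solve 6 (λ r a b c d δ →
      (r :* c :+ con 0ℚ :* d :* δ) :+ (con 0ℚ :* a :+ con 0ℚ :* b :* δ) := r :* c) refl r a b c d Dℚ)
    (solve 5 (λ r a b c d →
      (r :* d :+ con 0ℚ :* c) :+ (con 0ℚ :* b :+ con 0ℚ :* a) := r :* d) refl r a b c d)

  mulℂ-i√ : ∀ a b c d → mulℂ D (i√ D) ((a +√ b) +i (c +√ d))
    ≡ ((ℚ.- (d ℚ.* Dℚ)) +√ (ℚ.- c)) +i ((b ℚ.* Dℚ) +√ a)
  mulℂ-i√ a b c d = ℂD-cong
    (solve 5 (λ a b c d δ →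
      (con 0ℚ :* a :+ con 0ℚ :* b :* δ) :+ :- (con 0ℚ :* c :+ con 1ℚ :* d :* δ) := :- (d :* δ)) refl a b c d Dℚ)
    (solve 4 (λ a b c d →
      (con 0ℚ :* b :+ con 0ℚ :* a) :+ :- (con 0ℚ :* d :+ con 1ℚ :* c) := :- c) refl a b c d)
    (solve 5 (λ a b c d δ →
      (con 0ℚ :* c :+ con 0ℚ :* d :* δ) :+ (con 0ℚ :* a :+ con 1ℚ :* b :* δ) := b :* δ) refl a b c d Dℚ)
    (solve 4 (λ a b c d →
      (con 0ℚ :* d :+ con 0ℚ :* c) :+ (con 0ℚ :* b :+ con 1ℚ :* a) := a) refl a b c d)

  mulℂ-fromℤℂ-fromℤ⁴ : ∀ m a b c d →
    mulℂ D (fromℤℂ m) (fromℤ⁴ a b c d) ≡ fromℤ⁴ (m ℤ.* a) (m ℤ.* b) (m ℤ.* c) (m ℤ.* d)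
  mulℂ-fromℤℂ-fromℤ⁴ m a b c d =
    trans (mulℂ-real (fromℤ m) (fromℤ a) (fromℤ b) (fromℤ c) (fromℤ d))
    (sym (ℂD-cong (fromℤ-homo-* m a) (fromℤ-homo-* m b) (fromℤ-homo-* m c) (fromℤ-homo-* m d)))

  mulℂ-i√-fromℤ⁴ : ∀ a b c d →
    mulℂ D (i√ D) (fromℤ⁴ a b c d) ≡ fromℤ⁴ (ℤ.- (d ℤ.* + D)) (ℤ.- c) (b ℤ.* + D) a
  mulℂ-i√-fromℤ⁴ a b c d = trans (mulℂ-i√ (fromℤ a) (fromℤ b) (fromℤ c) (fromℤ d))
    (sym (ℂD-cong (trans (fromℤ-homo‿- (d ℤ.* + D)) (cong ℚ.-_ (fromℤ-homo-* d (+ D))))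
                  (fromℤ-homo‿- c) (fromℤ-homo-* b (+ D)) refl))

isZeroℝ : ∀ D x → ra x ≡ 0ℚ → rc x ℚ.* rc x ℚ.* fromℤ (+ D) ≡ 0ℚ → IsZeroℝ D x
isZeroℝ D (a +√ c) refl c²D≡0 = sym c²D≡0 , subst (ℚ._≤ 0ℚ) (sym (ℚP.*-zeroˡ c)) ℚP.≤-refl

subℂ-self : ∀ D z → IsZeroℂ D (subℂ z z)
subℂ-self D ((a +√ b) +i (c +√ d)) = isZeroℝ-sub-self a b , isZeroℝ-sub-self c d
  where
  isZeroℝ-sub-self : ∀ p q → IsZeroℝ D ((p ℚ.+ ℚ.- p) +√ (q ℚ.+ ℚ.- q))
  isZeroℝ-sub-self p q = isZeroℝ D _ (ℚP.+-inverseʳ p)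
    (trans (cong (λ t → t ℚ.* t ℚ.* fromℤ (+ D)) (ℚP.+-inverseʳ q)) (ℚP.*-zeroˡ (fromℤ (+ D))))

-- With D = 0 the √D-coordinates carry no information, so only the rational ones need to agree.
subℂ-rational-parts : ∀ z w → ra (re z) ≡ ra (re w) → ra (im z) ≡ ra (im w) →
  IsZeroℂ 0 (subℂ z w)
subℂ-rational-parts z w re≡ im≡ =
  isZeroℝ₀ _ (trans (cong (λ t → t ℚ.+ ℚ.- ra (re w)) re≡) (ℚP.+-inverseʳ (ra (re w)))) ,
  isZeroℝ₀ _ (trans (cong (λ t → t ℚ.+ ℚ.- ra (im w)) im≡) (ℚP.+-inverseʳ (ra (im w))))
  where
  isZeroℝ₀ : ∀ x → ra x ≡ 0ℚ → IsZeroℝ 0 x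
  isZeroℝ₀ x ra≡0 = isZeroℝ 0 x ra≡0 (ℚP.*-zeroʳ (rc x ℚ.* rc x))

1≉0 : ∀ D → ¬ IsZeroℝ D (1ℚ +√ 0ℚ)
1≉0 D (1≡0 , _) = ℚP.1≢0 (trans 1≡0 (ℚP.*-zeroˡ (fromℤ (+ D))))

√D≉0 : ∀ m → ¬ IsZeroℝ (suc m) (0ℚ +√ 1ℚ)
√D≉0 m (0≡D , _)
  with fromℤ-injective {+ 0} {+ suc m} (trans 0≡D (ℚP.*-identityˡ (fromℤ (+ suc m))))
... | ()

mulVecℤ : ∀ {n} → (Fin n → Fin n → ℤ) → (Fin n → ℤ) → Fin n → ℤ
mulVecℤ M a i = sumℤ (λ j → M i j ℤ.* a j)

δ : ∀ {n} → Fin n → Fin n → ℤ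
δ k j = if does (j Fin.≟ k) then + 1 else + 0

δ-refl : ∀ {n} (k : Fin n) → δ k k ≡ + 1
δ-refl k = cong (if_then + 1 else + 0) (dec-true (k Fin.≟ k) refl)

δ-≢ : ∀ {n} {k j : Fin n} → j ≢ k → δ k j ≡ + 0
δ-≢ {k = k} {j} j≢k = cong (if_then + 1 else + 0) (dec-false (j Fin.≟ k) j≢k)

module _ {n} (M : Fin n → Fin n → ℤ) where

  mulVecℤ-zero : ∀ i → mulVecℤ M (λ _ → + 0) i ≡ + 0
  mulVecℤ-zero i = sumℤ-zero (λ j → ℤP.*-zeroʳ (M i j))

  mulVecℤ-δ : ∀ k i → mulVecℤ M (δ k) i ≡ M i k
  mulVecℤ-δ k i = begin
    sumℤ (λ j → M i j ℤ.* δ k j)  ≡⟨ sumℤ-single _ k (λ j j≢k → trans (cong (M i j ℤ.*_) (δ-≢ j≢k))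
                                                                      (ℤP.*-zeroʳ (M i j))) ⟩
    M i k ℤ.* δ k k               ≡⟨ cong (M i k ℤ.*_) (δ-refl k) ⟩
    M i k ℤ.* + 1                 ≡⟨ ℤP.*-identityʳ (M i k) ⟩
    M i k                         ∎

  mulVec-fromℤ⁴ : ∀ D (a b c d : Fin n → ℤ) i →
    mulVec D M (λ j → fromℤ⁴ (a j) (b j) (c j) (d j)) i
      ≡ fromℤ⁴ (mulVecℤ M a i) (mulVecℤ M b i) (mulVecℤ M c i) (mulVecℤ M d i)
  mulVec-fromℤ⁴ D a b c d i = trans
    (cong (foldr addℂ zeroℂ) (map-cong (λ j → mulℂ-fromℤℂ-fromℤ⁴ D (M i j) (a j) (b j) (c j) (d j)) (allFin n)))
    (sumℂ-fromℤ⁴ _ _ _ _ (allFin n))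

  -- i√D · ((a + b√D) + i(c + d√D)) = (−dD − c√D) + i(bD + a√D), so M x = i√D x splits into
  -- four integer equations.
  i√-eigenvalue : ∀ D (a b c d : Fin n → ℤ) →
    (∀ i → mulVecℤ M a i ≡ ℤ.- (d i ℤ.* + D)) → (∀ i → mulVecℤ M b i ≡ ℤ.- c i) →
    (∀ i → mulVecℤ M c i ≡ b i ℤ.* + D) → (∀ i → mulVecℤ M d i ≡ a i) →
    ∀ k → ¬ IsZeroℂ D (fromℤ⁴ (a k) (b k) (c k) (d k)) → IsEigenvalue D M (i√ D)
  i√-eigenvalue D a b c d Ma Mb Mc Md k xₖ≉0 = x , (k , xₖ≉0) , λ i →
    subst (λ z → IsZeroℂ D (subℂ z (mulℂ D (i√ D) (x i)))) (sym (Mx≡i√Dx i))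
          (subℂ-self D (mulℂ D (i√ D) (x i)))
    where
    x : Fin n → ℂD
    x j = fromℤ⁴ (a j) (b j) (c j) (d j)

    Mx≡i√Dx : ∀ i → mulVec D M x i ≡ mulℂ D (i√ D) (x i)
    Mx≡i√Dx i = begin
      mulVec D M x i
        ≡⟨ mulVec-fromℤ⁴ D a b c d i ⟩
      fromℤ⁴ (mulVecℤ M a i) (mulVecℤ M b i) (mulVecℤ M c i) (mulVecℤ M d i)
        ≡⟨ ℂD-cong (cong fromℤ (Ma i)) (cong fromℤ (Mb i)) (cong fromℤ (Mc i)) (cong fromℤ (Md i)) ⟩
      fromℤ⁴ (ℤ.- (d i ℤ.* + D)) (ℤ.- c i) (b i ℤ.* + D) (a i)
        ≡⟨ mulℂ-i√-fromℤ⁴ D (a i) (b i) (c i) (d i) ⟨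
      mulℂ D (i√ D) (x i)
        ∎

  column⇒i√-eigenvalue : ∀ m k → (∀ i → mulVecℤ M (λ j → M j k) i ≡ ℤ.- (δ k i ℤ.* + suc m)) →
    IsEigenvalue (suc m) M (i√ (suc m))
  column⇒i√-eigenvalue m k MMₖ≡-Dδₖ =
    i√-eigenvalue (suc m) (λ j → M j k) (λ _ → + 0) (λ _ → + 0) (δ k)
      MMₖ≡-Dδₖ mulVecℤ-zero mulVecℤ-zero (mulVecℤ-δ k) k
      (λ xₖ≈0 → √D≉0 m (subst (λ t → IsZeroℝ (suc m) (0ℚ +√ fromℤ t)) (δ-refl k) (proj₂ xₖ≈0)))

  zero-column⇒i√0-eigenvalue : ∀ k → (∀ i → M i k ≡ + 0) → IsEigenvalue 0 M (i√ 0)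
  zero-column⇒i√0-eigenvalue k Mₖ≡0 = x , (k , xₖ≉0) , λ i →
    subst₂ (λ z w → IsZeroℂ 0 (subℂ z w)) (sym (Mx≡0 i)) (sym (mulℂ-i√-fromℤ⁴ 0 (δ k i) (+ 0) (+ 0) (+ 0)))
           (subℂ-rational-parts (fromℤ⁴ (+ 0) (+ 0) (+ 0) (+ 0)) (fromℤ⁴ (+ 0) (+ 0) (+ 0) (δ k i)) refl refl)
    where
    zeros : Fin n → ℤ
    zeros _ = + 0

    x : Fin n → ℂD
    x j = fromℤ⁴ (δ k j) (+ 0) (+ 0) (+ 0)

    Mx≡0 : ∀ i → mulVec 0 M x i ≡ fromℤ⁴ (+ 0) (+ 0) (+ 0) (+ 0)
    Mx≡0 i = trans (mulVec-fromℤ⁴ 0 (δ k) zeros zeros zeros i)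
      (ℂD-cong (cong fromℤ (trans (mulVecℤ-δ k i) (Mₖ≡0 i))) (cong fromℤ (mulVecℤ-zero i))
               (cong fromℤ (mulVecℤ-zero i)) (cong fromℤ (mulVecℤ-zero i)))

    xₖ≉0 : ¬ IsZeroℂ 0 (x k)
    xₖ≉0 xₖ≈0 = 1≉0 0 (subst (λ t → IsZeroℝ 0 (fromℤ t +√ 0ℚ)) (δ-refl k) (proj₁ xₖ≈0))

module _ {n} {G : SimpleGraph n} (σ : Orientation G) where

  private
    S : Fin n → Fin n → ℤ
    S = skewAdj σ

  not-both-arcs : ∀ i j → arc σ i j ≡ true → arc σ j i ≡ true → ⊥
  not-both-arcs i j eᵢⱼ eⱼᵢ =
    contradiction (subst₂ (λ p q → (p xor q) ≡ true) eᵢⱼ eⱼᵢ (edge⇒one σ i j (arc⇒edge σ i j eᵢⱼ))) λ ()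

  edge⇒some-arc : ∀ i j → Adj G i j ≡ true → arc σ i j ≡ false → arc σ j i ≡ false → ⊥
  edge⇒some-arc i j e eᵢⱼ eⱼᵢ =
    contradiction (subst₂ (λ p q → (p xor q) ≡ true) eᵢⱼ eⱼᵢ (edge⇒one σ i j e)) λ ()

  non-edge⇒no-arc : ∀ i j → Adj G i j ≡ false → arc σ i j ≡ false
  non-edge⇒no-arc i j ¬e with arc σ i j in eᵢⱼ
  ... | true  = contradiction (trans (sym ¬e) (arc⇒edge σ i j eᵢⱼ)) λ ()
  ... | false = refl

  skewAdj-antisym : ∀ i j → S i j ≡ ℤ.- S j i
  skewAdj-antisym i j with arc σ i j in eᵢⱼ | arc σ j i in eⱼᵢ
  ... | true  | true  = ⊥-elim (not-both-arcs i j eᵢⱼ eⱼᵢ)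
  ... | true  | false = refl
  ... | false | true  = refl
  ... | false | false = refl

  skewAdj-non-edge : ∀ i j → Adj G i j ≡ false → S i j ≡ + 0
  skewAdj-non-edge i j ¬e
    rewrite non-edge⇒no-arc i j ¬e | non-edge⇒no-arc j i (trans (SimpleGraph.sym G j i) ¬e) = refl

  skewAdj-edge² : ∀ i j → Adj G i j ≡ true → S i j ℤ.* S i j ≡ + 1
  skewAdj-edge² i j e with arc σ i j in eᵢⱼ | arc σ j i in eⱼᵢ
  ... | true  | true  = ⊥-elim (not-both-arcs i j eᵢⱼ eⱼᵢ)
  ... | true  | false = refl
  ... | false | true  = refl
  ... | false | false = ⊥-elim (edge⇒some-arc i j e eᵢⱼ eⱼᵢ)

  colDot-self : ∀ k → colDot S k k ≡ + degree G k
  colDot-self k = sum-indicator≡count (λ j → Adj G k j ≟ true) (λ i → S i k ℤ.* S i k)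
    (λ i e → skewAdj-edge² i k (trans (SimpleGraph.sym G i k) e))
    (λ i ¬e → cong (λ t → t ℤ.* t) (skewAdj-non-edge i k (trans (SimpleGraph.sym G i k) (¬-not ¬e))))
    (allFin n)

  degree-zero⇒column-zero : ∀ k → degree G k ≡ 0 → ∀ i → S i k ≡ + 0
  degree-zero⇒column-zero k deg≡0 i with Adj G i k in e
  ... | false = skewAdj-non-edge i k e
  ... | true  = contradiction (subst (0 ℕ.<_) deg≡0 (∈-length i∈N[k])) λ ()
    where
    i∈N[k] : i ∈ filter (λ j → Adj G k j ≟ true) (allFin n)
    i∈N[k] = ∈-filter⁺ (λ j → Adj G k j ≟ true) (∈-allFin i) (trans (SimpleGraph.sym G k i) e)

  skewAdj-column : ∀ k D → degree G k ≡ D → (∀ j → j ≢ k → colDot S k j ≡ + 0) →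
    ∀ i → mulVecℤ S (λ j → S j k) i ≡ ℤ.- (δ k i ℤ.* + D)
  skewAdj-column k D deg≡D orth i = begin
    sumℤ (λ j → S i j ℤ.* S j k)        ≡⟨ sumℤ-cong (λ j → S-swap j) ⟩
    sumℤ (λ j → ℤ.- (S j k ℤ.* S j i))  ≡⟨ sumℤ-neg (λ j → S j k ℤ.* S j i) ⟩
    ℤ.- colDot S k i                    ≡⟨ cong ℤ.-_ (colDot≡Dδ (i Fin.≟ k)) ⟩
    ℤ.- (δ k i ℤ.* + D)                 ∎
    where
    S-swap : ∀ j → S i j ℤ.* S j k ≡ ℤ.- (S j k ℤ.* S j i)
    S-swap j = begin
      S i j ℤ.* S j k          ≡⟨ cong (ℤ._* S j k) (skewAdj-antisym i j) ⟩
      ℤ.- S j i ℤ.* S j k      ≡⟨ ℤP.neg-distribˡ-* (S j i) (S j k) ⟨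
      ℤ.- (S j i ℤ.* S j k)    ≡⟨ cong ℤ.-_ (ℤP.*-comm (S j i) (S j k)) ⟩
      ℤ.- (S j k ℤ.* S j i)    ∎

    colDot≡Dδ : Dec (i ≡ k) → colDot S k i ≡ δ k i ℤ.* + D
    colDot≡Dδ (yes refl) = begin
      colDot S k k      ≡⟨ colDot-self k ⟩
      + degree G k      ≡⟨ cong +_ deg≡D ⟩
      + D               ≡⟨ ℤP.*-identityˡ (+ D) ⟨
      + 1 ℤ.* + D       ≡⟨ cong (ℤ._* + D) (δ-refl k) ⟨
      δ k k ℤ.* + D     ∎
    colDot≡Dδ (no i≢k) =
      trans (orth i i≢k) (sym (trans (cong (ℤ._* + D) (δ-≢ i≢k)) (ℤP.*-zeroˡ (+ D))))

theorem3p4 : (n : ℕ) (G : SimpleGraph n) (σ : Orientation G) →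
    (∃ λ k → (degree G k ≡ maxDegree G) ×
              (∀ j → j ≢ k → colDot (skewAdj σ) k j ≡ + 0)) →
    IsEigenvalue (maxDegree G) (skewAdj σ) (i√ (maxDegree G))
theorem3p4 _ G σ (k , deg≡Δ , orth) with maxDegree G
... | zero  = zero-column⇒i√0-eigenvalue (skewAdj σ) k (degree-zero⇒column-zero σ k deg≡Δ)
... | suc m = column⇒i√-eigenvalue (skewAdj σ) m k (skewAdj-column σ k (suc m) deg≡Δ orth)
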